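{- Let $G_1,G_2,G_3$ be simple connected graphs, each with the same number $m$ of vertices. Then $$\Delta(G_1,G_2)\le\Delta(G_1,G_3)+\Delta(G_3,G_2).$$
   Context: $\mathbb{F}$ is the field with two elements. A simple graph $G$ with vertices $v_1,\dots,v_m$ is regarded as a $1$-dimensional simplicial complex. A colouring $\varepsilon\in\mathbb{Z}_2^m$ colours $v_i$ black if $\varepsilon(i)=1$ and white otherwise; $|\varepsilon|$ is the number of black vertices; the weight of a simplex (vertex or edge) is its number of white vertices. The horizontal differential $\partial_h$ on the simplicial chain complex $C_*(G)$ over $\mathbb{F}$ sends a simplex $\sigma$ to the sum of the faces $\sigma\setminus\{v\}$ over black vertices $v\in\sigma$; $\mathrm{H}^h_i(G,\varepsilon,k)$ is the homology of $(C_*(G),\partial_h)$ in simplex dimension $i$ and weight $k$. For $0\le j\le m$, $\Theta(G,j)$ is the lexicographically ordered list of the $4$-tuples $(j,i,k,r)$, where $\varepsilon$ ranges over colourings with $|\varepsilon|=j$ and $(i,k)$ over the bidegrees with $r=\mathrm{rk}\,\mathrm{H}^h_i(G,\varepsilon,k)>0$. For graphs $G_1,G_2$ with the same number $m$ of vertices, the dissimilarity is $\Delta(G_1,G_2)=1-\frac{1}{m}\min\{j\ge0:\Theta(G_1,j)\neq\Theta(G_2,j)\}$ (with $\Delta(G_1,G_2)=0$ if no such $j$ exists). -}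

module Defs where

open import Data.Bool using (Bool; true; false; if_then_else_; _∧_; _xor_; not)
open import Data.Nat using (ℕ; zero; suc; _∸_; _<ᵇ_; _≡ᵇ_)
import Data.Nat.Properties as ℕP
open import Data.Fin using (Fin; toℕ)
import Data.Fin as Fin
open import Data.Vec using (Vec; []; _∷_; lookup; tabulate; zipWith; head; tail; countᵇ)
open import Data.List using (List; []; _∷_; map; concatMap; filterᵇ; filter; length; upTo; allFin; [_])
import Data.List as List
import Data.List.Properties as ListP
open import Data.Maybe using (Maybe; just; nothing)
open import Data.Product using (_×_; _,_)
import Data.Product.Properties as ProdP
open import Data.Product.Relation.Binary.Lex.NonStrict using (×-decTotalOrder)
import Data.List.Sort.MergeSort as MergeSort
open import Relation.Nullary using (¬?; does)
open import Relation.Binary.PropositionalEquality using (_≡_)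
open import Relation.Binary.Definitions using (DecidableEquality)
open import Data.Integer using (+_)
open import Data.Rational using (ℚ; 0ℚ; 1ℚ; _-_; _/_)

record SimpleGraph (m : ℕ) : Set where
  field
    adj    : Fin m → Fin m → Bool
    sym    : ∀ u v → adj u v ≡ adj v u
    irrefl : ∀ v → adj v v ≡ false
open SimpleGraph public

data Reachable {m : ℕ} (G : SimpleGraph m) : Fin m → Fin m → Set where
  here : ∀ {v} → Reachable G v v
  step : ∀ {u w v} → adj G u w ≡ true → Reachable G w v → Reachable G u v

Connected : ∀ {m} → SimpleGraph m → Set
Connected {m} G = ∀ (u v : Fin m) → Reachable G u v

-- Rank of a family of vectors over F = Bool (xor = addition),
-- by Gaussian elimination (recursion on the number of columns).

private
  findPivot : ∀ {n} → List (Vec Bool (suc n)) →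
              Maybe (Vec Bool (suc n) × List (Vec Bool (suc n)))
  findPivot [] = nothing
  findPivot (r ∷ rs) with head r | findPivot rs
  ... | true  | _ = just (r , rs)
  ... | false | nothing = nothing
  ... | false | just (p , rest) = just (p , r ∷ rest)

rank : ∀ {n} → List (Vec Bool n) → ℕ
rank {zero}  _    = 0
rank {suc n} rows with findPivot rows
... | nothing = rank (map tail rows)
... | just (p , rest) =
  suc (rank (map (λ r → tail (if head r then zipWith _xor_ r p else r)) rest))

Colouring : ℕ → Set
Colouring m = Vec Bool m          -- true = black

allColourings : ∀ m → List (Colouring m)
allColourings zero    = [] ∷ []
allColourings (suc m) =
  concatMap (λ ε → (false ∷ ε) ∷ (true ∷ ε) ∷ []) (allColourings m)

∣_∣c : ∀ {m} → Colouring m → ℕ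
∣ ε ∣c = countᵇ (λ b → b) ε

edges : ∀ {m} → SimpleGraph m → List (Fin m × Fin m)
edges {m} G =
  concatMap (λ u → map (λ v → (u , v))
    (filterᵇ (λ v → (toℕ u <ᵇ toℕ v) ∧ adj G u v) (allFin m))) (allFin m)

weightV : ∀ {m} → Colouring m → Fin m → ℕ
weightV ε v = if lookup ε v then 0 else 1

weightE : ∀ {m} → Colouring m → Fin m × Fin m → ℕ
weightE ε (u , v) = weightV ε u Data.Nat.+ weightV ε v

-- ∂_h {u,v} = [v black]·{u} + [u black]·{v}, as a vector in C_0 = F^m
-- (∂_h on vertices is 0: the chain complex is not augmented)
∂h : ∀ {m} → Colouring m → Fin m × Fin m → Vec Bool m
∂h ε (u , v) = tabulate λ w →
  (does (w Fin.≟ u) ∧ lookup ε v) xor (does (w Fin.≟ v) ∧ lookup ε u)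

rk∂ : ∀ {m} → SimpleGraph m → Colouring m → ℕ → ℕ
rk∂ G ε k = rank (map (∂h ε) (filterᵇ (λ e → weightE ε e ≡ᵇ k) (edges G)))

rkH : ∀ {m} → SimpleGraph m → Colouring m → ℕ → ℕ → ℕ
rkH {m} G ε 0 k =
  length (filterᵇ (λ v → weightV ε v ≡ᵇ k) (allFin m)) ∸ rk∂ G ε k
rkH G ε 1 k =
  length (filterᵇ (λ e → weightE ε e ≡ᵇ k) (edges G)) ∸ rk∂ G ε k
rkH G ε (suc (suc i)) k = 0

Tuple : Set
Tuple = ℕ × ℕ × ℕ × ℕ

_≟T_ : DecidableEquality Tuple
_≟T_ = ProdP.≡-dec ℕP._≟_ (ProdP.≡-dec ℕP._≟_ (ProdP.≡-dec ℕP._≟_ ℕP._≟_))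

lexOrder = ×-decTotalOrder ℕP.≤-decTotalOrder
             (×-decTotalOrder ℕP.≤-decTotalOrder
               (×-decTotalOrder ℕP.≤-decTotalOrder ℕP.≤-decTotalOrder))

sortLex : List Tuple → List Tuple
sortLex = MergeSort.sort lexOrder

-- simplex dimensions i ∈ {0,1}; weights k ∈ {0,1,2}
-- (a simplex of G has at most 2 vertices, so all other bidegrees vanish)
Θ : ∀ {m} → SimpleGraph m → ℕ → List Tuple
Θ {m} G j = sortLex
  (concatMap (λ ε → concatMap (λ i → concatMap (λ k →
      if 0 <ᵇ rkH G ε i k then [ (j , i , k , rkH G ε i k) ] else [])
    (upTo 3)) (upTo 2))
   (filterᵇ (λ ε → ∣ ε ∣c ≡ᵇ j) (allColourings m)))

firstDiff : ∀ {m} → SimpleGraph m → SimpleGraph m → Maybe ℕ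
firstDiff {m} G₁ G₂ =
  List.head (filter (λ j → ¬? (ListP.≡-dec _≟T_ (Θ G₁ j) (Θ G₂ j))) (upTo (suc m)))

Δ : ∀ {m} → SimpleGraph m → SimpleGraph m → ℚ
Δ {m} G₁ G₂ with firstDiff G₁ G₂ | m
... | nothing | _     = 0ℚ
... | just j  | zero  = 0ℚ     -- impossible: for m = 0 there is no difference
... | just j  | suc n = 1ℚ - ((+ j) / suc n)

module Submission where

open import Defs
open import Data.Nat using (ℕ)
open import Data.Rational using (_≤_; _+_)

open import Data.Nat as ℕ using (zero; suc)
import Data.Nat.Properties as ℕP
open import Data.Integer using (+_; +≤+)
import Data.Integer.Properties as ℤP
open import Data.Rational using (ℚ; 0ℚ; 1ℚ; _-_; _/_; toℚᵘ)
import Data.Rational.Properties as ℚP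
import Data.Rational.Unnormalised as ℚᵘ
import Data.Rational.Unnormalised.Properties as ℚᵘP
open import Data.List using (List; []; _∷_; filter; upTo)
import Data.List as List
import Data.List.Properties as ListP
open import Data.List.Relation.Unary.All using (All; []; _∷_)
import Data.List.Relation.Unary.All as All
import Data.List.Relation.Unary.All.Properties as AllP
open import Data.List.Relation.Unary.AllPairs using (AllPairs; []; _∷_)
import Data.List.Relation.Unary.AllPairs.Properties as AllPairsP
open import Data.Maybe using (Maybe; just; nothing; fromMaybe)
open import Data.Sum using (_⊎_; inj₁; inj₂)
open import Data.Empty using (⊥-elim)
open import Relation.Nullary using (¬?; yes; no)
open import Relation.Binary.Definitions using (DecidableEquality)
open import Relation.Binary.PropositionalEquality as ≡ using (_≡_; refl; trans; cong; cong₂)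

-- Let j(G, H) be the first index at which Θ(G, ·) and Θ(H, ·) differ (m if none).
-- Agreement below an index is transitive, so j is ultrametric:
-- j(G₁,G₂) ≥ min(j(G₁,G₃), j(G₃,G₂)). As Δ = 1 − j/m is antitone in j and
-- nonnegative, Δ(G₁,G₂) ≤ max(Δ(G₁,G₃), Δ(G₃,G₂)).

module FirstDifference {A : Set} (_≟_ : DecidableEquality A) where

  firstDifference : (ℕ → A) → (ℕ → A) → List ℕ → Maybe ℕ
  firstDifference x y L = List.head (filter (λ j → ¬? (x j ≟ y j)) L)

  agreementDepth : ℕ → (ℕ → A) → (ℕ → A) → List ℕ → ℕ
  agreementDepth d x y L = fromMaybe d (firstDifference x y L)

  agreementDepth≤ : ∀ {d} x y {L} → All (ℕ._≤ d) L → agreementDepth d x y L ℕ.≤ d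
  agreementDepth≤ x y [] = ℕP.≤-refl
  agreementDepth≤ x y {z ∷ _} (z≤d ∷ L≤d) with x z ≟ y z
  ... | yes _ = agreementDepth≤ x y L≤d
  ... | no  _ = z≤d

  ≤agreementDepth : ∀ {d s} x y {L} → All (s ℕ.≤_) L → s ℕ.≤ d → s ℕ.≤ agreementDepth d x y L
  ≤agreementDepth x y [] s≤d = s≤d
  ≤agreementDepth x y {z ∷ _} (s≤z ∷ s≤L) s≤d with x z ≟ y z
  ... | yes _ = ≤agreementDepth x y s≤L s≤d
  ... | no  _ = s≤z

  agreementDepth-ultrametric : ∀ {d} x y z {L} → AllPairs ℕ._≤_ L → All (ℕ._≤ d) L →
    agreementDepth d x z L ℕ.≤ agreementDepth d x y L ⊎
    agreementDepth d z y L ℕ.≤ agreementDepth d x y L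
  agreementDepth-ultrametric x y z [] [] = inj₁ ℕP.≤-refl
  agreementDepth-ultrametric x y z {i ∷ _} (i≤L ∷ sorted) (i≤d ∷ L≤d)
    with x i ≟ z i | z i ≟ y i
  ... | no _ | _ = inj₁ (≤agreementDepth x y (ℕP.≤-refl ∷ i≤L) i≤d)
  ... | yes _ | no _ = inj₂ (≤agreementDepth x y (ℕP.≤-refl ∷ i≤L) i≤d)
  ... | yes xz | yes zy with x i ≟ y i
  ...   | yes _ = agreementDepth-ultrametric x y z sorted L≤d
  ...   | no x≢y = ⊥-elim (x≢y (trans xz zy))

upTo-sorted : ∀ n → AllPairs ℕ._≤_ (upTo n)
upTo-sorted n = AllPairsP.applyUpTo⁺₁ (λ i → i) n (λ i<j _ → ℕP.<⇒≤ i<j)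

upTo-suc-bounded : ∀ n → All (ℕ._≤ n) (upTo (suc n))
upTo-suc-bounded n = All.map ℕP.<⇒≤pred (AllP.all-upTo (suc n))

dissimilarityAt : ℕ → ℕ → ℚ
dissimilarityAt n i = 1ℚ - (+ i) / suc n

toℚᵘ-/ : ∀ n i → toℚᵘ ((+ i) / suc n) ℚᵘ.≃ ℚᵘ.mkℚᵘ (+ i) n
toℚᵘ-/ n i = ℚP.toℚᵘ-fromℚᵘ (ℚᵘ.mkℚᵘ (+ i) n)

/-monoˡ-≤ : ∀ n {i j} → i ℕ.≤ j → (+ i) / suc n ≤ (+ j) / suc n
/-monoˡ-≤ n {i} {j} i≤j = ℚP.toℚᵘ-cancel-≤
  (ℚᵘP.≤-respˡ-≃ (ℚᵘP.≃-sym (toℚᵘ-/ n i)) (ℚᵘP.≤-respʳ-≃ (ℚᵘP.≃-sym (toℚᵘ-/ n j))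
    (ℚᵘ.*≤* (ℤP.*-monoʳ-≤-nonNeg (+ suc n) (+≤+ i≤j)))))

n/n≡1 : ∀ n → (+ suc n) / suc n ≡ 1ℚ
n/n≡1 n = ℚP.fromℚᵘ-cong {ℚᵘ.mkℚᵘ (+ suc n) n} {ℚᵘ.1ℚᵘ} (ℚᵘ.*≡* (ℤP.*-comm (+ suc n) (+ 1)))

dissimilarityAt-antitone : ∀ n {i j} → i ℕ.≤ j → dissimilarityAt n j ≤ dissimilarityAt n i
dissimilarityAt-antitone n i≤j = ℚP.+-monoʳ-≤ 1ℚ (ℚP.neg-antimono-≤ (/-monoˡ-≤ n i≤j))

dissimilarityAt-last : ∀ n → dissimilarityAt n (suc n) ≡ 0ℚ
dissimilarityAt-last n = trans (cong (1ℚ -_) (n/n≡1 n)) (ℚP.+-inverseʳ 1ℚ)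

dissimilarityAt-nonNeg : ∀ n {i} → i ℕ.≤ suc n → 0ℚ ≤ dissimilarityAt n i
dissimilarityAt-nonNeg n i≤n+1 =
  ℚP.≤-trans (ℚP.≤-reflexive (≡.sym (dissimilarityAt-last n))) (dissimilarityAt-antitone n i≤n+1)

p≤q⇒p≤q+r : ∀ {p q r} → p ≤ q → 0ℚ ≤ r → p ≤ q + r
p≤q⇒p≤q+r {p} {q} {r} p≤q 0≤r =
  ℚP.≤-trans (ℚP.≤-reflexive (≡.sym (ℚP.+-identityʳ p))) (ℚP.+-mono-≤ p≤q 0≤r)

dissimilarityAt-triangle : ∀ n {i j k} → j ℕ.≤ suc n → k ℕ.≤ suc n → j ℕ.≤ i ⊎ k ℕ.≤ i →
  dissimilarityAt n i ≤ dissimilarityAt n j + dissimilarityAt n k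
dissimilarityAt-triangle n j≤n+1 k≤n+1 (inj₁ j≤i) =
  p≤q⇒p≤q+r (dissimilarityAt-antitone n j≤i) (dissimilarityAt-nonNeg n k≤n+1)
dissimilarityAt-triangle n {j = j} {k} j≤n+1 k≤n+1 (inj₂ k≤i) =
  ℚP.≤-trans (p≤q⇒p≤q+r (dissimilarityAt-antitone n k≤i) (dissimilarityAt-nonNeg n j≤n+1))
             (ℚP.≤-reflexive (ℚP.+-comm (dissimilarityAt n k) (dissimilarityAt n j)))

open FirstDifference (ListP.≡-dec _≟T_)

depth : ∀ {m} → SimpleGraph m → SimpleGraph m → ℕ
depth {m} G₁ G₂ = agreementDepth m (Θ G₁) (Θ G₂) (upTo (suc m))

-- Mirrors the body of Δ. Going through it keeps (+ i) / suc n out of the goal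
-- when abstracting over firstDiff, which would otherwise unfold the gcd.
dissimilarity : ℕ → Maybe ℕ → ℚ
dissimilarity n nothing  = 0ℚ
dissimilarity n (just j) = dissimilarityAt n j

dissimilarity≡dissimilarityAt : ∀ n x → dissimilarity n x ≡ dissimilarityAt n (fromMaybe (suc n) x)
dissimilarity≡dissimilarityAt n nothing  = ≡.sym (dissimilarityAt-last n)
dissimilarity≡dissimilarityAt n (just _) = refl

Δ≡dissimilarity : ∀ {n} (G₁ G₂ : SimpleGraph (suc n)) → Δ G₁ G₂ ≡ dissimilarity n (firstDiff G₁ G₂)
Δ≡dissimilarity G₁ G₂ with firstDiff G₁ G₂
... | nothing = refl
... | just _  = refl

Δ≡dissimilarityAt-depth : ∀ {n} (G₁ G₂ : SimpleGraph (suc n)) → Δ G₁ G₂ ≡ dissimilarityAt n (depth G₁ G₂)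
Δ≡dissimilarityAt-depth {n} G₁ G₂ =
  trans (Δ≡dissimilarity G₁ G₂) (dissimilarity≡dissimilarityAt n (firstDiff G₁ G₂))

Δ-empty : ∀ (G₁ G₂ : SimpleGraph 0) → Δ G₁ G₂ ≡ 0ℚ
Δ-empty G₁ G₂ with firstDiff G₁ G₂
... | nothing = refl
... | just _  = refl

depth≤ : ∀ {m} (G₁ G₂ : SimpleGraph m) → depth G₁ G₂ ℕ.≤ m
depth≤ {m} G₁ G₂ = agreementDepth≤ (Θ G₁) (Θ G₂) (upTo-suc-bounded m)

depth-ultrametric : ∀ {m} (G₁ G₂ G₃ : SimpleGraph m) →
  depth G₁ G₃ ℕ.≤ depth G₁ G₂ ⊎ depth G₃ G₂ ℕ.≤ depth G₁ G₂
depth-ultrametric {m} G₁ G₂ G₃ =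
  agreementDepth-ultrametric (Θ G₁) (Θ G₂) (Θ G₃) (upTo-sorted (suc m)) (upTo-suc-bounded m)

proposition5p9 : ∀ {m : ℕ} (G₁ G₂ G₃ : SimpleGraph m) →
    Connected G₁ → Connected G₂ → Connected G₃ →
    Δ G₁ G₂ ≤ Δ G₁ G₃ + Δ G₃ G₂
proposition5p9 {zero} G₁ G₂ G₃ _ _ _ = begin
  Δ G₁ G₂           ≡⟨ Δ-empty G₁ G₂ ⟩
  0ℚ                ≡⟨ cong₂ _+_ (≡.sym (Δ-empty G₁ G₃)) (≡.sym (Δ-empty G₃ G₂)) ⟩
  Δ G₁ G₃ + Δ G₃ G₂ ∎
  where open ℚP.≤-Reasoning
proposition5p9 {suc n} G₁ G₂ G₃ _ _ _ = begin
  Δ G₁ G₂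
    ≡⟨ Δ≡dissimilarityAt-depth G₁ G₂ ⟩
  dissimilarityAt n (depth G₁ G₂)
    ≤⟨ dissimilarityAt-triangle n (depth≤ G₁ G₃) (depth≤ G₃ G₂) (depth-ultrametric G₁ G₂ G₃) ⟩
  dissimilarityAt n (depth G₁ G₃) + dissimilarityAt n (depth G₃ G₂)
    ≡⟨ cong₂ _+_ (≡.sym (Δ≡dissimilarityAt-depth G₁ G₃)) (≡.sym (Δ≡dissimilarityAt-depth G₃ G₂)) ⟩
  Δ G₁ G₃ + Δ G₃ G₂ ∎
  where open ℚP.≤-Reasoning
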